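{- There is an absolute constant $d_0$ such that, for any integer $d\geq d_0$, letting $S=\lceil 2d/(9\log d)\rceil$, there is a separated family $\mathcal{L}=(L_k)_{2\leq k\leq S}$ of gapped $k$-languages $L_k\subset[k]^d$ such that $|L_k|\geq \frac{10}{11}(k-1)^d$ for every $2\leq k\leq S$.
   Context: Here $\log$ is the natural logarithm and $[k]=\{1,\dots,k\}$. A $k$-language is a set $L_k\subset[k]^d$ of words $w=(w_i)_{1\leq i\leq d}$. $L_k$ misses $j$ at coordinate $i_0$ if every $w\in L_k$ has $w_{i_0}\neq j$; $L_k$ is gapped if for each $1\leq i\leq d$, $L_k$ misses $k-1$ at $i$ or misses $k$ at $i$. For $2\leq k<k'$, languages $L_k\subset[k]^d$ and $L_{k'}\subset[k']^d$ are separated if for every $w\in L_k$ and $w'\in L_{k'}$ there is some $i$ with $w_i<k<k'=w'_i$. A family $(L_k)_{2\leq k\leq S}$ is separated if $L_k$ and $L_{k'}$ are separated for all $2\leq k<k'\leq S$. -}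

module Defs where

open import Data.Nat using (ℕ; zero; suc; _+_; _*_; _∸_; _^_; _≤_; _<_)
open import Data.Fin using (Fin; toℕ)
open import Data.Vec using (Vec; lookup)
open import Data.List using (List; length)
open import Data.List.Membership.Propositional using (_∈_)
open import Data.List.Relation.Unary.Unique.Propositional using (Unique)
open import Data.Product using (Σ; _×_; ∃; ∃-syntax)
open import Data.Sum using (_⊎_)
open import Relation.Nullary using (¬_)
open import Relation.Binary.PropositionalEquality using (_≡_; _≢_)

-- A word w ∈ [k]^d is a Vec (Fin k) d; the letter j ∈ [k] = {1,…,k}
-- is represented by the element of Fin k with toℕ = j - 1.
-- So the numeric value of the letter at coordinate i is  letter w i.

Word : ℕ → ℕ → Set
Word k d = Vec (Fin k) d

letter : ∀ {k d} → Word k d → Fin d → ℕ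
letter w i = suc (toℕ (lookup w i))

-- A k-language L_k ⊆ [k]^d, represented as a duplicate-free list of words
-- (so that its cardinality |L_k| is the length of the list).
record Language (k d : ℕ) : Set where
  field
    words  : List (Word k d)
    unique : Unique words
open Language public

_∈L_ : ∀ {k d} → Word k d → Language k d → Set
w ∈L L = w ∈ words L

∣_∣L : ∀ {k d} → Language k d → ℕ
∣ L ∣L = length (words L)

Misses : ∀ {k d} → Language k d → ℕ → Fin d → Set
Misses L j i₀ = ∀ w → w ∈L L → letter w i₀ ≢ j

Gapped : ∀ {k d} → Language k d → Set
Gapped {k} {d} L = ∀ (i : Fin d) → Misses L (k ∸ 1) i ⊎ Misses L k i

Separated : ∀ {k k' d} → Language k d → Language k' d → Set
Separated {k} {k'} {d} L L' =
  ∀ w w' → w ∈L L → w' ∈L L' →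
    ∃[ i ] (letter w i < k × letter w' i ≡ k')

-- Encoding S = ⌈ 2d / (9 log d) ⌉ without real numbers.
--
-- expScaled b n = n! · Σ_{j=0}^{n} b^j / j!   (a natural number):
--   expScaled b 0       = 1
--   expScaled b (n + 1) = (n + 1) · expScaled b n + b^(n+1)
expScaled : ℕ → ℕ → ℕ
expScaled b zero    = 1
expScaled b (suc n) = suc n * expScaled b n + b ^ suc n

factorial : ℕ → ℕ
factorial zero    = 1
factorial (suc n) = suc n * factorial n

-- ExpLe b m  means  e^b ≤ m  (e^b is the supremum of the partial sums
-- Σ_{j≤n} b^j/j!), i.e.  b ≤ log m.
ExpLe : ℕ → ℕ → Set
ExpLe b m = ∀ n → expScaled b n ≤ m * factorial n

-- IsCeilS d S  means  S = ⌈ 2d / (9 log d) ⌉, i.e. S is the least natural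
-- number with  S ≥ 2d/(9 log d), i.e. with 9 S log d ≥ 2d, i.e. e^(2d) ≤ d^(9S).
-- (For d ≥ 2, log d > 0 so these are equivalent.)
IsCeilS : ℕ → ℕ → Set
IsCeilS d S = ExpLe (2 * d) (d ^ (9 * S)) × ¬ ExpLe (2 * d) (d ^ (9 * (S ∸ 1)))

-- For k = n + 2 ≤ S, give each coordinate i < d the type walsh(n + 1, i) ∈ {0, 1}, a character of
-- 𝔽₂^(r+2) evaluated at i mod 2^(r+2), where 2^(r+2) > S.  L_k consists of words of [k − 1]^d in
-- which the letter k − 1 is replaced by k on the coordinates of type 1, so L_k is gapped; keeping
-- only the words that carry the letter k somewhere on D(n, j) = {type_n = 1, type_j = 0} for every
-- j < n makes the family separated.  Distinct nonzero characters are jointly balanced, so each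
-- D(n, j) has at least m ≥ 2d/9 coordinates, and at most a fraction (n/(n+1))^m of [k − 1]^d
-- avoids k on it.  Minimality of S = ⌈2d/(9 log d)⌉ says e^(2d) > d^(9(S−1)); since
-- e ≤ (1 + 1/n)^(n+1) this forces (1 + 1/n)^m ≥ 11n, so the union bound over the n values of j
-- loses at most a fraction 1/11.
module Submission where

open import Defs
open import Data.Nat
import Data.Nat as ℕ
open import Data.Nat.Properties
open import Data.Nat.DivMod using (m≡m%n+[m/n]*n; m%n<n; m/n*n≤m)
open import Data.Nat.ListAction using (sum)
open import Data.Nat.Tactic.RingSolver using (solve-∀)
open import Data.Bool using (Bool; true; false; not; _∧_; _xor_; if_then_else_; T; T?)
open import Data.Bool.ListAction using (all)
open import Data.Bool.Properties
  using (xor-identityʳ; xor-assoc; xor-comm; ∧-zeroʳ; ∧-identityʳ; ∧-distribʳ-xor; ∧-conicalˡ; ∧-conicalʳ;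
         not-involutive; T-not-≡; xor-∧-commutativeRing)
open import Algebra.Bundles using (CommutativeRing)
open import Algebra.Properties.CommutativeSemigroup
  (CommutativeRing.+-commutativeSemigroup xor-∧-commutativeRing) using (interchange)
open import Data.Fin using (Fin; zero; suc; toℕ; fromℕ; inject₁; punchIn)
open import Data.Fin.Properties using (punchInᵢ≢i; punchIn-injective; toℕ-injective; toℕ-fromℕ; toℕ-inject₁; toℕ<n)
open import Data.Vec using (Vec; []; _∷_; lookup)
open import Data.Vec.Properties using (∷-injective)
open import Data.List using (List; []; _∷_; [_]; _++_; map; length; cartesianProductWith; allFin; tabulate; filterᵇ; upTo)
open import Data.List.Properties using (length-map; length-tabulate; length-upTo; map-tabulate)
open import Data.List.Membership.Propositional.Properties using (∈-map⁻; ∈-filter⁻; ∈-upTo⁺; ∈-upTo⁻)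
open import Data.List.Relation.Unary.All using (All; []; _∷_)
import Data.List.Relation.Unary.All as All
open import Data.List.Relation.Unary.All.Properties using (all⁺)
open import Data.List.Relation.Unary.AllPairs using ([]; _∷_)
open import Data.List.Relation.Unary.Unique.Propositional using (Unique)
import Data.List.Relation.Unary.Unique.Propositional.Properties as Unique
open import Data.Product using (Σ; _×_; _,_; proj₂; ∃-syntax)
open import Data.Sum using (inj₁; inj₂)
open import Function using (_∘_; id; Equivalence)
open import Relation.Binary.PropositionalEquality using (_≡_; _≢_; refl; sym; trans; cong; cong₂; subst; module ≡-Reasoning)
open import Relation.Nullary using (¬_; yes; no; contradiction)

-- Bounds on e^b

[m*n]^o≡m^o*n^o : ∀ m n o → (m * n) ^ o ≡ m ^ o * n ^ o
[m*n]^o≡m^o*n^o m n zero    = refl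
[m*n]^o≡m^o*n^o m n (suc o) = begin
  m * n * (m * n) ^ o      ≡⟨ cong (m * n *_) ([m*n]^o≡m^o*n^o m n o) ⟩
  m * n * (m ^ o * n ^ o)  ≡⟨ shuffle m n (m ^ o) (n ^ o) ⟩
  m * m ^ o * (n * n ^ o)  ∎
  where
  open ≡-Reasoning
  shuffle : ∀ a b c d → a * b * (c * d) ≡ a * c * (b * d)
  shuffle = solve-∀

rising : ℕ → ℕ → ℕ
rising x zero    = 1
rising x (suc N) = rising x N * (x + N)

^≤rising : ∀ x N → x ^ N ≤ rising x N
^≤rising x zero    = ≤-refl
^≤rising x (suc N) = begin
  x * x ^ N         ≡⟨ *-comm x (x ^ N) ⟩
  x ^ N * x         ≤⟨ *-mono-≤ (^≤rising x N) (m≤m+n x N) ⟩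
  rising x N * (x + N) ∎
  where open ≤-Reasoning

rising-suc : ∀ x N → rising x (suc N) ≡ x * rising (suc x) N
rising-suc x zero    = trans (*-identityˡ (x + 0)) (trans (+-identityʳ x) (sym (*-identityʳ x)))
rising-suc x (suc N) = begin
  rising x (suc N) * (x + suc N)        ≡⟨ cong₂ _*_ (rising-suc x N) (+-suc x N) ⟩
  x * rising (suc x) N * (suc x + N)    ≡⟨ *-assoc x _ _ ⟩
  x * (rising (suc x) N * (suc x + N))  ∎
  where open ≡-Reasoning

rising-pascal : ∀ x N → rising (suc x) (suc N) ≡ suc N * rising (suc x) N + rising x (suc N)
rising-pascal x N = begin
  rising (suc x) N * (suc x + N)                ≡⟨ expand (rising (suc x) N) x N ⟩
  suc N * rising (suc x) N + x * rising (suc x) N ≡⟨ cong (suc N * rising (suc x) N +_) (sym (rising-suc x N)) ⟩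
  suc N * rising (suc x) N + rising x (suc N)   ∎
  where
  open ≡-Reasoning
  expand : ∀ r x N → r * (suc x + N) ≡ suc N * r + x * r
  expand = solve-∀

module _ (n : ℕ) where

  -- N! (n+1)^N Σ_{j ≤ N} rising K j / (j! (n+1)^j), a partial sum of the binomial series of
  -- (1 − 1/(n+1))^(−K).
  negBinomialSum : ℕ → ℕ → ℕ
  negBinomialSum K zero    = 1
  negBinomialSum K (suc N) = suc N * suc n * negBinomialSum K N + rising K (suc N)

  negBinomialSum-suc : ∀ K N → n * negBinomialSum (suc K) N + rising (suc K) N ≡ suc n * negBinomialSum K N
  negBinomialSum-suc K zero    = n*1+1≡[1+n]*1 n
    where
    n*1+1≡[1+n]*1 : ∀ n → n * 1 + 1 ≡ suc n * 1
    n*1+1≡[1+n]*1 = solve-∀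
  negBinomialSum-suc K (suc N) = begin
    n * (A * H′ + R′) + R′
      ≡⟨ cong (λ r → n * (A * H′ + r) + r) (rising-pascal K N) ⟩
    n * (A * H′ + (suc N * R + Rₖ)) + (suc N * R + Rₖ)
      ≡⟨ regroup n N H′ R Rₖ ⟩
    suc n * (suc N * (n * H′ + R) + Rₖ)
      ≡⟨ cong (λ h → suc n * (suc N * h + Rₖ)) (negBinomialSum-suc K N) ⟩
    suc n * (suc N * (suc n * negBinomialSum K N) + Rₖ)
      ≡⟨ cong (λ h → suc n * (h + Rₖ)) (sym (*-assoc (suc N) (suc n) _)) ⟩
    suc n * (A * negBinomialSum K N + Rₖ) ∎
    where
    open ≡-Reasoning
    A  = suc N * suc n
    H′ = negBinomialSum (suc K) N
    R  = rising (suc K) N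
    R′ = rising (suc K) (suc N)
    Rₖ = rising K (suc N)
    regroup : ∀ n N h r s → n * (suc N * suc n * h + (suc N * r + s)) + (suc N * r + s)
                          ≡ suc n * (suc N * (n * h + r) + s)
    regroup = solve-∀

  negBinomialSum-zero : ∀ N → negBinomialSum 0 N ≡ factorial N * suc n ^ N
  negBinomialSum-zero zero    = refl
  negBinomialSum-zero (suc N) = begin
    suc N * suc n * negBinomialSum 0 N + rising 0 (suc N)
      ≡⟨ cong₂ (λ h r → suc N * suc n * h + r) (negBinomialSum-zero N) (rising-suc 0 N) ⟩
    suc N * suc n * (factorial N * suc n ^ N) + 0
      ≡⟨ regroup N n (factorial N) (suc n ^ N) ⟩
    suc N * factorial N * (suc n * suc n ^ N) ∎
    where
    open ≡-Reasoning
    regroup : ∀ N n f p → suc N * suc n * (f * p) + 0 ≡ suc N * f * (suc n * p)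
    regroup = solve-∀

  negBinomialSum-bound : ∀ K N → n ^ K * negBinomialSum K N ≤ suc n ^ K * negBinomialSum 0 N
  negBinomialSum-bound zero    N = ≤-refl
  negBinomialSum-bound (suc K) N = begin
    n * n ^ K * negBinomialSum (suc K) N
      ≡⟨ *-assoc n (n ^ K) _ ⟩
    n * (n ^ K * negBinomialSum (suc K) N)
      ≡⟨ x*[y*z]≡y*[x*z] n (n ^ K) _ ⟩
    n ^ K * (n * negBinomialSum (suc K) N)
      ≤⟨ *-monoʳ-≤ (n ^ K) (m≤m+n _ (rising (suc K) N)) ⟩
    n ^ K * (n * negBinomialSum (suc K) N + rising (suc K) N)
      ≡⟨ cong (n ^ K *_) (negBinomialSum-suc K N) ⟩
    n ^ K * (suc n * negBinomialSum K N)
      ≡⟨ x*[y*z]≡y*[x*z] (n ^ K) (suc n) _ ⟩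
    suc n * (n ^ K * negBinomialSum K N)
      ≤⟨ *-monoʳ-≤ (suc n) (negBinomialSum-bound K N) ⟩
    suc n * (suc n ^ K * negBinomialSum 0 N)
      ≡⟨ *-assoc (suc n) (suc n ^ K) _ ⟨
    suc n * suc n ^ K * negBinomialSum 0 N ∎
    where
    open ≤-Reasoning
    x*[y*z]≡y*[x*z] : ∀ x y z → x * (y * z) ≡ y * (x * z)
    x*[y*z]≡y*[x*z] = solve-∀

  expScaled≤negBinomialSum : ∀ b N → expScaled b N * suc n ^ N ≤ negBinomialSum (b * suc n) N
  expScaled≤negBinomialSum b zero    = ≤-refl
  expScaled≤negBinomialSum b (suc N) = begin
    (suc N * expScaled b N + b ^ suc N) * (suc n * suc n ^ N)
      ≡⟨ expand (suc N) (expScaled b N) (b ^ suc N) (suc n) (suc n ^ N) ⟩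
    suc N * suc n * (expScaled b N * suc n ^ N) + b ^ suc N * suc n ^ suc N
      ≤⟨ +-mono-≤ (*-monoʳ-≤ (suc N * suc n) (expScaled≤negBinomialSum b N))
                  (≤-reflexive (sym ([m*n]^o≡m^o*n^o b (suc n) (suc N)))) ⟩
    suc N * suc n * negBinomialSum K N + K ^ suc N
      ≤⟨ +-monoʳ-≤ (suc N * suc n * negBinomialSum K N) (^≤rising K (suc N)) ⟩
    suc N * suc n * negBinomialSum K N + rising K (suc N) ∎
    where
    open ≤-Reasoning
    K = b * suc n
    expand : ∀ a e c s p → (a * e + c) * (s * p) ≡ a * s * (e * p) + c * (s * p)
    expand = solve-∀

-- Termwise b^j ≤ rising (b(n+1)) j / (n+1)^j, so e^b is at most the binomial series of
-- (1 − 1/(n+1))^(−b(n+1)).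
e^b≤[1+1/n]^[b*[1+n]] : ∀ n b N → expScaled b N * n ^ (b * suc n) ≤ factorial N * suc n ^ (b * suc n)
e^b≤[1+1/n]^[b*[1+n]] n b N = *-cancelʳ-≤ _ _ (suc n ^ N) {{m^n≢0 (suc n) N}} (begin
  expScaled b N * n ^ K * suc n ^ N        ≡⟨ x*y*z≡y*[x*z] (expScaled b N) (n ^ K) _ ⟩
  n ^ K * (expScaled b N * suc n ^ N)      ≤⟨ *-monoʳ-≤ (n ^ K) (expScaled≤negBinomialSum n b N) ⟩
  n ^ K * negBinomialSum n K N             ≤⟨ negBinomialSum-bound n K N ⟩
  suc n ^ K * negBinomialSum n 0 N         ≡⟨ cong (suc n ^ K *_) (negBinomialSum-zero n N) ⟩
  suc n ^ K * (factorial N * suc n ^ N)    ≡⟨ x*[y*z]≡y*x*z (suc n ^ K) (factorial N) _ ⟩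
  factorial N * suc n ^ K * suc n ^ N      ∎)
  where
  open ≤-Reasoning
  K = b * suc n
  x*y*z≡y*[x*z] : ∀ x y z → x * y * z ≡ y * (x * z)
  x*y*z≡y*[x*z] = solve-∀
  x*[y*z]≡y*x*z : ∀ x y z → x * (y * z) ≡ y * x * z
  x*[y*z]≡y*x*z = solve-∀

ExpLe-from-ratio : ∀ {b} c n .{{_ : NonZero n}} M → b * suc n ≤ M → suc n ^ M ≤ c * n ^ M → ExpLe b c
ExpLe-from-ratio {b} c n M K≤M ratio N = *-cancelʳ-≤ _ _ (n ^ M) {{m^n≢0 n M}} (begin
  expScaled b N * n ^ M                     ≡⟨ cong (expScaled b N *_) (^-split n) ⟩
  expScaled b N * (n ^ K * n ^ e)           ≡⟨ *-assoc (expScaled b N) _ _ ⟨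
  expScaled b N * n ^ K * n ^ e             ≤⟨ *-mono-≤ (e^b≤[1+1/n]^[b*[1+n]] n b N) (^-monoˡ-≤ e (n≤1+n n)) ⟩
  factorial N * suc n ^ K * suc n ^ e       ≡⟨ *-assoc (factorial N) _ _ ⟩
  factorial N * (suc n ^ K * suc n ^ e)     ≡⟨ cong (factorial N *_) (^-split (suc n)) ⟨
  factorial N * suc n ^ M                   ≤⟨ *-monoʳ-≤ (factorial N) ratio ⟩
  factorial N * (c * n ^ M)                 ≡⟨ *-assoc (factorial N) c _ ⟨
  factorial N * c * n ^ M                   ≡⟨ cong (_* n ^ M) (*-comm (factorial N) c) ⟩
  c * factorial N * n ^ M                   ∎)
  where
  open ≤-Reasoning
  K = b * suc n
  e = M ∸ K
  ^-split : ∀ x → x ^ M ≡ x ^ K * x ^ e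
  ^-split x = trans (cong (x ^_) (sym (m+[n∸m]≡n K≤M))) (^-distribˡ-+-* x K e)

ExpLe-from-2^ : ∀ {b d} a t → 2 ^ a ≤ d → b * 2 ≤ a * t → ExpLe b (d ^ t)
ExpLe-from-2^ {b} {d} a t 2^a≤d b*2≤a*t = ExpLe-from-ratio (d ^ t) 1 (a * t) b*2≤a*t (begin
  2 ^ (a * t)        ≡⟨ ^-*-assoc 2 a t ⟨
  (2 ^ a) ^ t        ≤⟨ ^-monoˡ-≤ t 2^a≤d ⟩
  d ^ t              ≡⟨ *-identityʳ (d ^ t) ⟨
  d ^ t * 1          ≡⟨ cong (d ^ t *_) (^-zeroˡ (a * t)) ⟨
  d ^ t * 1 ^ (a * t) ∎)
  where open ≤-Reasoning

-- Consequences of the minimality of S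

-- If (n+1)^m ≤ a n · n^m, then e^b ≤ ((n+1)/n)^(mt) ≤ (a n)^t ≤ d^t.
ratio-from-¬ExpLe : ∀ {b d t} a n m → ¬ ExpLe b (d ^ t) → b * suc n ≤ m * t → a * n ≤ d → a * n * n ^ m ≤ suc n ^ m
ratio-from-¬ExpLe a zero m _ _ _ = ≤-trans (≤-reflexive (cong (_* 0 ^ m) (*-zeroʳ a))) z≤n
ratio-from-¬ExpLe {b} {d} {t} a n@(suc _) m e^b≰d^t b[1+n]≤mt an≤d with a * n * n ^ m ≤? suc n ^ m
... | yes ok = ok
... | no ¬ok = contradiction (ExpLe-from-ratio (d ^ t) n (m * t) b[1+n]≤mt (begin
  suc n ^ (m * t)         ≡⟨ ^-*-assoc (suc n) m t ⟨
  (suc n ^ m) ^ t         ≤⟨ ^-monoˡ-≤ t (<⇒≤ (≰⇒> ¬ok)) ⟩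
  (a * n * n ^ m) ^ t     ≡⟨ [m*n]^o≡m^o*n^o (a * n) (n ^ m) t ⟩
  (a * n) ^ t * (n ^ m) ^ t ≤⟨ *-mono-≤ (^-monoˡ-≤ t an≤d) (≤-reflexive (^-*-assoc n m t)) ⟩
  d ^ t * n ^ (m * t)     ∎)) e^b≰d^t
  where open ≤-Reasoning

ratio-from-ceiling : ∀ {d S n m} → ¬ ExpLe (2 * d) (d ^ (9 * (S ∸ 1))) → 16 * S + 64 ≤ d → 2 * d ≤ 9 * m → 2 + n ≤ S →
  11 * n * n ^ m ≤ suc n ^ m
ratio-from-ceiling {d} {S} {n} {m} e^2d≰d^t 16S+64≤d 2d≤9m 2+n≤S = ratio-from-¬ExpLe 11 n m e^2d≰d^t
  (begin
    2 * d * suc n       ≤⟨ *-mono-≤ 2d≤9m (∸-monoˡ-≤ 1 2+n≤S) ⟩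
    9 * m * (S ∸ 1)     ≡⟨ regroup m (S ∸ 1) ⟩
    m * (9 * (S ∸ 1))   ∎)
  (begin
    11 * n              ≤⟨ *-mono-≤ (m≤m+n 11 5) (≤-trans (m≤n+m n 2) 2+n≤S) ⟩
    16 * S              ≤⟨ m≤m+n (16 * S) 64 ⟩
    16 * S + 64         ≤⟨ 16S+64≤d ⟩
    d                   ∎)
  where
  open ≤-Reasoning
  regroup : ∀ m s → 9 * m * s ≡ m * (9 * s)
  regroup = solve-∀

-- Otherwise 4d ≤ 15 · 9(S − 1), and e^(2d) ≤ 2^(4d) ≤ (2^15)^(9(S−1)) ≤ d^(9(S−1)).
16S+64≤d : ∀ {d S} → 2 ^ 15 ≤ d → ¬ ExpLe (2 * d) (d ^ (9 * (S ∸ 1))) → 16 * S + 64 ≤ d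
16S+64≤d {d} {S} 2^15≤d e^2d≰d^t with 16 * S + 64 ≤? d
... | yes ok = ok
... | no ¬ok with 6 ≤? S
...   | no S<6 = contradiction 2^15≤d (<⇒≱ (begin-strict
        d              <⟨ ≰⇒> ¬ok ⟩
        16 * S + 64    ≤⟨ +-monoˡ-≤ 64 (*-monoʳ-≤ 16 (≤-pred (≰⇒> S<6))) ⟩
        144            <⟨ m≤m+n 145 32623 ⟩
        2 ^ 15         ∎))
  where open ≤-Reasoning
...   | yes (s≤s {n = s} 5≤s) = contradiction (ExpLe-from-2^ 15 (9 * s) 2^15≤d (begin
        2 * d * 2            ≡⟨ *-comm (2 * d) 2 ⟩
        2 * (2 * d)          ≤⟨ *-monoʳ-≤ 2 (*-monoʳ-≤ 2 (<⇒≤ (≰⇒> ¬ok))) ⟩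
        2 * (2 * (16 * suc s + 64)) ≡⟨ expand s ⟩
        64 * s + 320         ≤⟨ +-monoʳ-≤ (64 * s) (≤-trans (m≤m+n 320 35) (*-monoʳ-≤ 71 5≤s)) ⟩
        64 * s + 71 * s      ≡⟨ collect s ⟩
        15 * (9 * s)         ∎)) e^2d≰d^t
  where
  open ≤-Reasoning
  expand : ∀ s → 2 * (2 * (16 * suc s + 64)) ≡ 64 * s + 320
  expand = solve-∀
  collect : ∀ s → 64 * s + 71 * s ≡ 15 * (9 * s)
  collect = solve-∀

bit : Bool → ℕ
bit false = 0
bit true  = 1

countBelow : (ℕ → Bool) → ℕ → ℕ
countBelow p zero    = 0
countBelow p (suc l) = bit (p 0) + countBelow (p ∘ ℕ.suc) l

countBelow-cong : ∀ {p q} → (∀ i → p i ≡ q i) → ∀ l → countBelow p l ≡ countBelow q l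
countBelow-cong p≗q zero    = refl
countBelow-cong p≗q (suc l) = cong₂ _+_ (cong bit (p≗q 0)) (countBelow-cong (p≗q ∘ ℕ.suc) l)

countBelow-+ : ∀ p m n → countBelow p (m + n) ≡ countBelow p m + countBelow (λ i → p (m + i)) n
countBelow-+ p zero    n = refl
countBelow-+ p (suc m) n = trans (cong (bit (p 0) +_) (countBelow-+ (p ∘ ℕ.suc) m n))
                                 (sym (+-assoc (bit (p 0)) _ _))

countBelow-mono : ∀ p {m n} → m ≤ n → countBelow p m ≤ countBelow p n
countBelow-mono p {m} {n} m≤n = begin
  countBelow p m                                        ≤⟨ m≤m+n _ _ ⟩
  countBelow p m + countBelow (λ i → p (m + i)) (n ∸ m) ≡⟨ countBelow-+ p m (n ∸ m) ⟨
  countBelow p (m + (n ∸ m))                            ≡⟨ cong (countBelow p) (m+[n∸m]≡n m≤n) ⟩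
  countBelow p n                                        ∎
  where open ≤-Reasoning

countBelow-periodic : ∀ {p} P → (∀ i → p (P + i) ≡ p i) → ∀ q → countBelow p (q * P) ≡ q * countBelow p P
countBelow-periodic         P per zero    = refl
countBelow-periodic {p = p} P per (suc q) = begin
  countBelow p (P + q * P)                               ≡⟨ countBelow-+ p P (q * P) ⟩
  countBelow p P + countBelow (λ i → p (P + i)) (q * P)  ≡⟨ cong (countBelow p P +_) (countBelow-cong per (q * P)) ⟩
  countBelow p P + countBelow p (q * P)                  ≡⟨ cong (countBelow p P +_) (countBelow-periodic P per q) ⟩
  countBelow p P + q * countBelow p P                    ∎
  where open ≡-Reasoning

countBelow-double : ∀ p l → countBelow p (l + l) ≡ countBelow (λ i → p (i + i)) l + countBelow (λ i → p (suc (i + i))) l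
countBelow-double p zero    = refl
countBelow-double p (suc l) = begin
  bit (p 0) + countBelow (p ∘ ℕ.suc) (l + suc l)
    ≡⟨ cong (λ m → bit (p 0) + countBelow (p ∘ ℕ.suc) m) (+-suc l l) ⟩
  bit (p 0) + (bit (p 1) + countBelow (p ∘ ℕ.suc ∘ ℕ.suc) (l + l))
    ≡⟨ cong (λ c → bit (p 0) + (bit (p 1) + c)) (countBelow-double (p ∘ ℕ.suc ∘ ℕ.suc) l) ⟩
  bit (p 0) + (bit (p 1) + (countBelow (λ i → p (2 + (i + i))) l + countBelow (λ i → p (3 + (i + i))) l))
    ≡⟨ regroup (bit (p 0)) (bit (p 1)) _ _ ⟩
  (bit (p 0) + countBelow (λ i → p (2 + (i + i))) l) + (bit (p 1) + countBelow (λ i → p (3 + (i + i))) l)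
    ≡⟨ cong₂ (λ c c′ → (bit (p 0) + c) + (bit (p 1) + c′))
             (countBelow-cong (cong p ∘ even-suc) l) (countBelow-cong (cong p ∘ cong suc ∘ even-suc) l) ⟩
  (bit (p 0) + countBelow (λ i → p (suc i + suc i)) l) + (bit (p 1) + countBelow (λ i → p (suc (suc i + suc i))) l) ∎
  where
  open ≡-Reasoning
  regroup : ∀ a b c d → a + (b + (c + d)) ≡ (a + c) + (b + d)
  regroup = solve-∀
  even-suc : ∀ i → 2 + (i + i) ≡ suc i + suc i
  even-suc i = cong suc (sym (+-suc i i))

countBelow-complement : ∀ p l → countBelow p l + countBelow (not ∘ p) l ≡ l
countBelow-complement p zero    = refl
countBelow-complement p (suc l) with p 0 | countBelow-complement (p ∘ ℕ.suc) l
... | true  | ih = cong suc ih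
... | false | ih = trans (+-suc (countBelow (p ∘ ℕ.suc) l) _) (cong suc ih)

countBelow-inclusion-exclusion : ∀ p q l →
  2 * countBelow (λ i → p i ∧ not (q i)) l + countBelow q l ≡ countBelow p l + countBelow (λ i → p i xor q i) l
countBelow-inclusion-exclusion p q zero    = refl
countBelow-inclusion-exclusion p q (suc l) = begin
  2 * (bit (p 0 ∧ not (q 0)) + A) + (bit (q 0) + B)
    ≡⟨ regroup (bit (p 0 ∧ not (q 0))) A (bit (q 0)) B ⟩
  (2 * bit (p 0 ∧ not (q 0)) + bit (q 0)) + (2 * A + B)
    ≡⟨ cong₂ _+_ (pointwise (p 0) (q 0)) (countBelow-inclusion-exclusion (p ∘ ℕ.suc) (q ∘ ℕ.suc) l) ⟩
  (bit (p 0) + bit (p 0 xor q 0)) + (C + D)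
    ≡⟨ regroup′ (bit (p 0)) (bit (p 0 xor q 0)) C D ⟩
  (bit (p 0) + C) + (bit (p 0 xor q 0) + D) ∎
  where
  open ≡-Reasoning
  A = countBelow (λ i → p (suc i) ∧ not (q (suc i))) l
  B = countBelow (q ∘ ℕ.suc) l
  C = countBelow (p ∘ ℕ.suc) l
  D = countBelow (λ i → p (suc i) xor q (suc i)) l
  regroup : ∀ a x b y → 2 * (a + x) + (b + y) ≡ (2 * a + b) + (2 * x + y)
  regroup = solve-∀
  regroup′ : ∀ a b x y → (a + b) + (x + y) ≡ (a + x) + (b + y)
  regroup′ = solve-∀
  pointwise : ∀ x y → 2 * bit (x ∧ not y) + bit y ≡ bit x + bit (x xor y)
  pointwise true  true  = refl
  pointwise true  false = refl
  pointwise false true  = refl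
  pointwise false false = refl

count : {A : Set} → (A → Bool) → List A → ℕ
count p []       = 0
count p (x ∷ xs) = bit (p x) + count p xs

count-cong : ∀ {A : Set} {p q : A → Bool} → (∀ x → p x ≡ q x) → ∀ xs → count p xs ≡ count q xs
count-cong p≗q []       = refl
count-cong p≗q (x ∷ xs) = cong₂ _+_ (cong bit (p≗q x)) (count-cong p≗q xs)

count-true : ∀ {A : Set} (xs : List A) → count (λ _ → true) xs ≡ length xs
count-true []       = refl
count-true (x ∷ xs) = cong suc (count-true xs)

count-false : ∀ {A : Set} (xs : List A) → count (λ _ → false) xs ≡ 0
count-false []       = refl
count-false (x ∷ xs) = count-false xs

count-∧ˡ : ∀ {A : Set} b (q : A → Bool) xs → count (λ x → b ∧ q x) xs ≡ bit b * count q xs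
count-∧ˡ true  q xs = sym (+-identityʳ (count q xs))
count-∧ˡ false q xs = count-false xs

count-++ : ∀ {A : Set} (p : A → Bool) xs ys → count p (xs ++ ys) ≡ count p xs + count p ys
count-++ p []       ys = refl
count-++ p (x ∷ xs) ys = trans (cong (bit (p x) +_) (count-++ p xs ys)) (sym (+-assoc (bit (p x)) _ _))

count-map : ∀ {A B : Set} (p : B → Bool) (f : A → B) xs → count p (map f xs) ≡ count (p ∘ f) xs
count-map p f []       = refl
count-map p f (x ∷ xs) = cong (bit (p (f x)) +_) (count-map p f xs)

length-filterᵇ : ∀ {A : Set} (p : A → Bool) xs → length (filterᵇ p xs) ≡ count p xs
length-filterᵇ p []       = refl
length-filterᵇ p (x ∷ xs) with p x
... | true  = cong suc (length-filterᵇ p xs)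
... | false = length-filterᵇ p xs

count-∧-complement : ∀ {A : Set} (b g : A → Bool) xs → count g xs ≤ count (λ x → not (b x) ∧ g x) xs + count b xs
count-∧-complement b g []       = z≤n
count-∧-complement b g (x ∷ xs) with b x | g x | count-∧-complement b g xs
... | false | true  | ih = s≤s ih
... | false | false | ih = ih
... | true  | true  | ih = ≤-trans (s≤s ih) (≤-reflexive (sym (+-suc _ _)))
... | true  | false | ih = ≤-trans ih (+-monoʳ-≤ _ (n≤1+n _))

count-cartesianProduct : ∀ {A : Set} {l} (P : Vec A (suc l) → Bool) (p : A → Bool) (q : Vec A l → Bool) →
  (∀ x u → P (x ∷ u) ≡ p x ∧ q u) → ∀ xs ys → count P (cartesianProductWith _∷_ xs ys) ≡ count p xs * count q ys
count-cartesianProduct P p q P≡ []       ys = refl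
count-cartesianProduct P p q P≡ (x ∷ xs) ys = begin
  count P (map (x ∷_) ys ++ cartesianProductWith _∷_ xs ys)
    ≡⟨ count-++ P (map (x ∷_) ys) _ ⟩
  count P (map (x ∷_) ys) + count P (cartesianProductWith _∷_ xs ys)
    ≡⟨ cong₂ _+_ row (count-cartesianProduct P p q P≡ xs ys) ⟩
  bit (p x) * count q ys + count p xs * count q ys
    ≡⟨ *-distribʳ-+ (count q ys) (bit (p x)) (count p xs) ⟨
  (bit (p x) + count p xs) * count q ys ∎
  where
  open ≡-Reasoning
  row : count P (map (x ∷_) ys) ≡ bit (p x) * count q ys
  row = trans (count-map P (x ∷_) ys) (trans (count-cong (P≡ x) ys) (count-∧ˡ (p x) q ys))

count-all-not : ∀ {A J : Set} (bad : J → A → Bool) js xs →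
  length xs ≤ count (λ x → all (λ j → not (bad j x)) js) xs + sum (map (λ j → count (bad j) xs) js)
count-all-not bad []       xs = ≤-reflexive (sym (trans (+-identityʳ _) (count-true xs)))
count-all-not bad (j ∷ js) xs = begin
  length xs                                                    ≤⟨ count-all-not bad js xs ⟩
  count G xs + B                                               ≤⟨ +-monoˡ-≤ B (count-∧-complement (bad j) G xs) ⟩
  count (λ x → not (bad j x) ∧ G x) xs + count (bad j) xs + B  ≡⟨ +-assoc (count (λ x → not (bad j x) ∧ G x) xs) _ _ ⟩
  count (λ x → not (bad j x) ∧ G x) xs + (count (bad j) xs + B) ∎
  where
  open ≤-Reasoning
  G = λ x → all (λ j → not (bad j x)) js
  B = sum (map (λ j → count (bad j) xs) js)

*-sum-≤ : ∀ {J : Set} a T (f : J → ℕ) {js} → All (λ j → a * f j ≤ T) js → a * sum (map f js) ≤ length js * T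
*-sum-≤ a T f []                 = ≤-reflexive (*-zeroʳ a)
*-sum-≤ a T f {j ∷ js} (bd ∷ bds) = begin
  a * (f j + sum (map f js))         ≡⟨ *-distribˡ-+ a (f j) _ ⟩
  a * f j + a * sum (map f js)       ≤⟨ +-mono-≤ bd (*-sum-≤ a T f bds) ⟩
  T + length js * T                  ∎
  where open ≤-Reasoning

sum-upTo-≤ : ∀ a T n (f : ℕ → ℕ) → (∀ j → j < n → a * n * f j ≤ T) → a * sum (map f (upTo n)) ≤ T
sum-upTo-≤ a T zero    f _     = ≤-trans (≤-reflexive (*-zeroʳ a)) z≤n
sum-upTo-≤ a T n@(suc _) f bound = *-cancelˡ-≤ n (begin
  n * (a * sum (map f (upTo n)))    ≡⟨ x*[y*z]≡y*x*z n a _ ⟩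
  a * n * sum (map f (upTo n))      ≤⟨ *-sum-≤ (a * n) T f (All.tabulate (λ j∈ → bound _ (∈-upTo⁻ j∈))) ⟩
  length (upTo n) * T               ≡⟨ cong (_* T) (length-upTo n) ⟩
  n * T                             ∎)
  where
  open ≤-Reasoning
  x*[y*z]≡y*x*z : ∀ x y z → x * (y * z) ≡ y * x * z
  x*[y*z]≡y*x*z = solve-∀

-- Walsh functions

odd : ℕ → Bool
odd zero          = false
odd (suc zero)    = true
odd (suc (suc n)) = odd n

infixr 5 _∷ᵇ_

_∷ᵇ_ : Bool → ℕ → ℕ
β ∷ᵇ x = bit β + (x + x)

∷ᵇ-suc : ∀ β x → β ∷ᵇ suc x ≡ suc (suc (β ∷ᵇ x))
∷ᵇ-suc β x = shift (bit β) x
  where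
  shift : ∀ b x → b + (suc x + suc x) ≡ suc (suc (b + (x + x)))
  shift = solve-∀

odd-∷ᵇ : ∀ β x → odd (β ∷ᵇ x) ≡ β
odd-∷ᵇ false zero    = refl
odd-∷ᵇ true  zero    = refl
odd-∷ᵇ β     (suc x) = trans (cong odd (∷ᵇ-suc β x)) (odd-∷ᵇ β x)

⌊∷ᵇ/2⌋ : ∀ β x → ⌊ β ∷ᵇ x /2⌋ ≡ x
⌊∷ᵇ/2⌋ false zero    = refl
⌊∷ᵇ/2⌋ true  zero    = refl
⌊∷ᵇ/2⌋ β     (suc x) = trans (cong ⌊_/2⌋ (∷ᵇ-suc β x)) (cong suc (⌊∷ᵇ/2⌋ β x))

odd∷ᵇ⌊/2⌋ : ∀ a → odd a ∷ᵇ ⌊ a /2⌋ ≡ a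
odd∷ᵇ⌊/2⌋ zero          = refl
odd∷ᵇ⌊/2⌋ (suc zero)    = refl
odd∷ᵇ⌊/2⌋ (suc (suc a)) = trans (∷ᵇ-suc (odd a) ⌊ a /2⌋) (cong (ℕ.suc ∘ ℕ.suc) (odd∷ᵇ⌊/2⌋ a))

∷ᵇ-injective : ∀ {β γ x y} → β ∷ᵇ x ≡ γ ∷ᵇ y → β ≡ γ × x ≡ y
∷ᵇ-injective {β} {γ} {x} {y} e =
  trans (sym (odd-∷ᵇ β x)) (trans (cong odd e) (odd-∷ᵇ γ y)) ,
  trans (sym (⌊∷ᵇ/2⌋ β x)) (trans (cong ⌊_/2⌋ e) (⌊∷ᵇ/2⌋ γ y))

∷ᵇ-< : ∀ β {x m} → x < m → β ∷ᵇ x < 2 * m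
∷ᵇ-< β {x} {m} x<m = begin-strict
  bit β + (x + x)      ≤⟨ +-monoˡ-≤ (x + x) (bit≤1 β) ⟩
  suc (x + x)          <⟨ s≤s (+-monoʳ-< x x<m) ⟩
  suc (x + m)          ≤⟨ +-monoˡ-≤ m x<m ⟩
  m + m                ≡⟨ cong (m +_) (+-identityʳ m) ⟨
  2 * m                ∎
  where
  open ≤-Reasoning
  bit≤1 : ∀ β → bit β ≤ 1
  bit≤1 false = z≤n
  bit≤1 true  = ≤-refl

⌊/2⌋-< : ∀ {a m} → a < 2 * m → ⌊ a /2⌋ < m
⌊/2⌋-< {a} {m} a<2m = ≰⇒> λ m≤h → <⇒≱ a<2m (begin
  2 * m              ≡⟨ cong (m +_) (+-identityʳ m) ⟩
  m + m              ≤⟨ +-mono-≤ m≤h m≤h ⟩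
  h + h              ≤⟨ m≤n+m (h + h) (bit (odd a)) ⟩
  odd a ∷ᵇ h         ≡⟨ odd∷ᵇ⌊/2⌋ a ⟩
  a                  ∎)
  where
  open ≤-Reasoning
  h = ⌊ a /2⌋

-- The parity of the common 1-bits of the lowest r binary digits of a and i, i.e. the character
-- (−1)^(a·i) of 𝔽₂^r.
walsh : ℕ → ℕ → ℕ → Bool
walsh zero    a i = false
walsh (suc r) a i = (odd a ∧ odd i) xor walsh r ⌊ a /2⌋ ⌊ i /2⌋

walsh-zero : ∀ r i → walsh r 0 i ≡ false
walsh-zero zero    i = refl
walsh-zero (suc r) i = walsh-zero r ⌊ i /2⌋

walsh-∷ᵇ : ∀ r a β i → walsh (suc r) a (β ∷ᵇ i) ≡ (odd a ∧ β) xor walsh r ⌊ a /2⌋ i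
walsh-∷ᵇ r a β i = cong₂ (λ γ j → (odd a ∧ γ) xor walsh r ⌊ a /2⌋ j) (odd-∷ᵇ β i) (⌊∷ᵇ/2⌋ β i)

walsh-periodic : ∀ r a i → walsh r a (2 ^ r + i) ≡ walsh r a i
walsh-periodic zero    a i = refl
walsh-periodic (suc r) a i = begin
  walsh (suc r) a (2 * 2 ^ r + i)
    ≡⟨ cong (walsh (suc r) a) shift ⟩
  walsh (suc r) a (odd i ∷ᵇ (2 ^ r + ⌊ i /2⌋))
    ≡⟨ walsh-∷ᵇ r a (odd i) _ ⟩
  (odd a ∧ odd i) xor walsh r ⌊ a /2⌋ (2 ^ r + ⌊ i /2⌋)
    ≡⟨ cong ((odd a ∧ odd i) xor_) (walsh-periodic r ⌊ a /2⌋ ⌊ i /2⌋) ⟩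
  walsh (suc r) a i ∎
  where
  open ≡-Reasoning
  shift : 2 * 2 ^ r + i ≡ odd i ∷ᵇ (2 ^ r + ⌊ i /2⌋)
  shift = trans (cong (2 * 2 ^ r +_) (sym (odd∷ᵇ⌊/2⌋ i))) (regroup (2 ^ r) (bit (odd i)) ⌊ i /2⌋)
    where
    regroup : ∀ m b h → 2 * m + (b + (h + h)) ≡ b + ((m + h) + (m + h))
    regroup = solve-∀

countBelow-walsh-split : ∀ r a u → countBelow (λ i → walsh (suc r) a i xor u) (2 ^ suc r)
  ≡ countBelow (λ i → walsh r ⌊ a /2⌋ i xor u) (2 ^ r) + countBelow (λ i → walsh r ⌊ a /2⌋ i xor (odd a xor u)) (2 ^ r)
countBelow-walsh-split r a u = begin
  countBelow p (2 * 2 ^ r)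
    ≡⟨ cong (λ m → countBelow p (2 ^ r + m)) (+-identityʳ (2 ^ r)) ⟩
  countBelow p (2 ^ r + 2 ^ r)
    ≡⟨ countBelow-double p (2 ^ r) ⟩
  countBelow (λ i → p (false ∷ᵇ i)) (2 ^ r) + countBelow (λ i → p (true ∷ᵇ i)) (2 ^ r)
    ≡⟨ cong₂ _+_ (countBelow-cong even (2 ^ r)) (countBelow-cong oddᵢ (2 ^ r)) ⟩
  countBelow (λ i → w i xor u) (2 ^ r) + countBelow (λ i → w i xor (odd a xor u)) (2 ^ r) ∎
  where
  open ≡-Reasoning
  p = λ i → walsh (suc r) a i xor u
  w = walsh r ⌊ a /2⌋
  even : ∀ i → p (false ∷ᵇ i) ≡ w i xor u
  even i = cong (_xor u) (trans (walsh-∷ᵇ r a false i) (cong (_xor w i) (∧-zeroʳ (odd a))))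
  oddᵢ : ∀ i → p (true ∷ᵇ i) ≡ w i xor (odd a xor u)
  oddᵢ i = begin
    walsh (suc r) a (true ∷ᵇ i) xor u  ≡⟨ cong (_xor u) (walsh-∷ᵇ r a true i) ⟩
    ((odd a ∧ true) xor w i) xor u     ≡⟨ cong (λ β → (β xor w i) xor u) (∧-identityʳ (odd a)) ⟩
    (odd a xor w i) xor u              ≡⟨ cong (_xor u) (xor-comm (odd a) (w i)) ⟩
    (w i xor odd a) xor u              ≡⟨ xor-assoc (w i) (odd a) u ⟩
    w i xor (odd a xor u)              ∎

walsh-balanced : ∀ r a u → 0 < a → a < 2 ^ suc r → countBelow (λ i → walsh (suc r) a i xor u) (2 ^ suc r) ≡ 2 ^ r
walsh-balanced r a u 0<a a<2^[1+r] =
  trans (countBelow-walsh-split r a u) (halves r ⌊ a /2⌋ (⌊/2⌋-< a<2^[1+r]) odd-a u)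
  where
  odd-a : ⌊ a /2⌋ ≡ 0 → odd a ≡ true
  odd-a h≡0 with odd a in eq
  ... | true  = refl
  ... | false = contradiction (trans (sym (odd∷ᵇ⌊/2⌋ a)) (cong₂ _∷ᵇ_ eq h≡0)) (>⇒≢ 0<a)
  halves : ∀ r h → h < 2 ^ r → (h ≡ 0 → odd a ≡ true) → ∀ u →
    countBelow (λ i → walsh r h i xor u) (2 ^ r) + countBelow (λ i → walsh r h i xor (odd a xor u)) (2 ^ r) ≡ 2 ^ r
  halves r zero _ h≡0⇒odd-a u rewrite h≡0⇒odd-a refl =
    trans (cong₂ _+_ (countBelow-cong (λ i → cong (_xor u) (walsh-zero r i)) (2 ^ r))
                     (countBelow-cong (λ i → cong (_xor not u) (walsh-zero r i)) (2 ^ r)))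
          (countBelow-complement (λ _ → u) (2 ^ r))
  halves (suc r) h@(suc _) h<2^[1+r] _ u =
    trans (cong₂ _+_ (walsh-balanced r h u z<s h<2^[1+r]) (walsh-balanced r h (odd a xor u) z<s h<2^[1+r]))
          (cong (2 ^ r +_) (sym (+-identityʳ (2 ^ r))))
  halves zero (suc _) (s≤s ()) _ _

xorᵇ : ℕ → ℕ → ℕ → ℕ
xorᵇ zero    a b = 0
xorᵇ (suc r) a b = (odd a xor odd b) ∷ᵇ xorᵇ r ⌊ a /2⌋ ⌊ b /2⌋

walsh-xorᵇ : ∀ r a b i → walsh r (xorᵇ r a b) i ≡ walsh r a i xor walsh r b i
walsh-xorᵇ zero    a b i = refl
walsh-xorᵇ (suc r) a b i = begin
  walsh (suc r) (β ∷ᵇ x) i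
    ≡⟨ cong₂ (λ γ y → (γ ∧ odd i) xor walsh r y ⌊ i /2⌋) (odd-∷ᵇ β x) (⌊∷ᵇ/2⌋ β x) ⟩
  (β ∧ odd i) xor walsh r x ⌊ i /2⌋
    ≡⟨ cong₂ _xor_ (∧-distribʳ-xor (odd i) (odd a) (odd b)) (walsh-xorᵇ r ⌊ a /2⌋ ⌊ b /2⌋ ⌊ i /2⌋) ⟩
  ((odd a ∧ odd i) xor (odd b ∧ odd i)) xor (walsh r ⌊ a /2⌋ ⌊ i /2⌋ xor walsh r ⌊ b /2⌋ ⌊ i /2⌋)
    ≡⟨ interchange (odd a ∧ odd i) (odd b ∧ odd i) (walsh r ⌊ a /2⌋ ⌊ i /2⌋) (walsh r ⌊ b /2⌋ ⌊ i /2⌋) ⟩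
  walsh (suc r) a i xor walsh (suc r) b i ∎
  where
  open ≡-Reasoning
  β = odd a xor odd b
  x = xorᵇ r ⌊ a /2⌋ ⌊ b /2⌋

xorᵇ-< : ∀ r a b → xorᵇ r a b < 2 ^ r
xorᵇ-< zero    a b = z<s
xorᵇ-< (suc r) a b = ∷ᵇ-< (odd a xor odd b) (xorᵇ-< r ⌊ a /2⌋ ⌊ b /2⌋)

xorᵇ≡0⇒≡ : ∀ r {a b} → a < 2 ^ r → b < 2 ^ r → xorᵇ r a b ≡ 0 → a ≡ b
xorᵇ≡0⇒≡ zero    {zero} {zero} _ _ _ = refl
xorᵇ≡0⇒≡ zero    {suc _} (s≤s ()) _ _
xorᵇ≡0⇒≡ zero    {b = suc _} _ (s≤s ()) _
xorᵇ≡0⇒≡ (suc r) {a} {b} a< b< e with ∷ᵇ-injective {y = 0} e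
... | odd-a-xor-odd-b≡false , x≡0 = begin
  a                     ≡⟨ odd∷ᵇ⌊/2⌋ a ⟨
  odd a ∷ᵇ ⌊ a /2⌋      ≡⟨ cong₂ _∷ᵇ_ (xor≡false⇒≡ (odd a) (odd b) odd-a-xor-odd-b≡false)
                                      (xorᵇ≡0⇒≡ r (⌊/2⌋-< a<) (⌊/2⌋-< b<) x≡0) ⟩
  odd b ∷ᵇ ⌊ b /2⌋      ≡⟨ odd∷ᵇ⌊/2⌋ b ⟩
  b                     ∎
  where
  open ≡-Reasoning
  xor≡false⇒≡ : ∀ x y → x xor y ≡ false → x ≡ y
  xor≡false⇒≡ false false _ = refl
  xor≡false⇒≡ true  true  _ = refl

-- Inclusion–exclusion over the balanced characters of a, b and a ⊕ b.
walsh-difference : ∀ r {a b} → 0 < a → 0 < b → a ≢ b → a < 2 ^ (2 + r) → b < 2 ^ (2 + r) →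
  countBelow (λ i → walsh (2 + r) a i ∧ not (walsh (2 + r) b i)) (2 ^ (2 + r)) ≡ 2 ^ r
walsh-difference r {a} {b} 0<a 0<b a≢b a<P b<P =
  *-cancelˡ-≡ _ _ 2 (+-cancelʳ-≡ (2 ^ suc r) _ _ (begin
    2 * N + 2 ^ suc r
      ≡⟨ cong (2 * N +_) (balanced 0<b b<P) ⟨
    2 * N + countBelow (walsh R b) P
      ≡⟨ countBelow-inclusion-exclusion (walsh R a) (walsh R b) P ⟩
    countBelow (walsh R a) P + countBelow (λ i → walsh R a i xor walsh R b i) P
      ≡⟨ cong (countBelow (walsh R a) P +_) (countBelow-cong (λ i → sym (walsh-xorᵇ R a b i)) P) ⟩
    countBelow (walsh R a) P + countBelow (walsh R (xorᵇ R a b)) P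
      ≡⟨ cong₂ _+_ (balanced 0<a a<P) (balanced 0<a⊕b (xorᵇ-< R a b)) ⟩
    2 ^ suc r + 2 ^ suc r ∎))
  where
  open ≡-Reasoning
  R = 2 + r
  P = 2 ^ R
  N = countBelow (λ i → walsh R a i ∧ not (walsh R b i)) P
  balanced : ∀ {c} → 0 < c → c < P → countBelow (walsh R c) P ≡ 2 ^ suc r
  balanced {c} 0<c c<P = trans (countBelow-cong (λ i → sym (xor-identityʳ (walsh R c i))) P)
                               (walsh-balanced (suc r) c false 0<c c<P)
  0<a⊕b : 0 < xorᵇ R a b
  0<a⊕b = n≢0⇒n>0 (a≢b ∘ xorᵇ≡0⇒≡ R a<P b<P)

walsh-difference-≥ : ∀ r {a b} d q → 0 < a → 0 < b → a ≢ b → a < 2 ^ (2 + r) → b < 2 ^ (2 + r) →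
  q * 2 ^ (2 + r) ≤ d → q * 2 ^ r ≤ countBelow (λ i → walsh (2 + r) a i ∧ not (walsh (2 + r) b i)) d
walsh-difference-≥ r {a} {b} d q 0<a 0<b a≢b a<P b<P qP≤d = begin
  q * 2 ^ r                ≡⟨ cong (q *_) (walsh-difference r 0<a 0<b a≢b a<P b<P) ⟨
  q * countBelow D P       ≡⟨ countBelow-periodic P periodic q ⟨
  countBelow D (q * P)     ≤⟨ countBelow-mono D qP≤d ⟩
  countBelow D d           ∎
  where
  open ≤-Reasoning
  R = 2 + r
  P = 2 ^ R
  D = λ i → walsh R a i ∧ not (walsh R b i)
  periodic : ∀ i → D (P + i) ≡ D i
  periodic i = cong₂ (λ x y → x ∧ not y) (walsh-periodic R a i) (walsh-periodic R b i)

-- Words avoiding the last symbol on a set of coordinates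

vectors : {A : Set} → List A → (l : ℕ) → List (Vec A l)
vectors xs zero    = [ [] ]
vectors xs (suc l) = cartesianProductWith _∷_ xs (vectors xs l)

vectors-unique : ∀ {A : Set} {xs : List A} → Unique xs → ∀ l → Unique (vectors xs l)
vectors-unique xs! zero    = [] ∷ []
vectors-unique xs! (suc l) = Unique.cartesianProductWith⁺ _∷_ ∷-injective xs! (vectors-unique xs! l)

length-vectors : ∀ {A : Set} (xs : List A) l → length (vectors xs l) ≡ length xs ^ l
length-vectors xs zero    = refl
length-vectors xs (suc l) = begin
  length (vectors xs (suc l))
    ≡⟨ count-true (vectors xs (suc l)) ⟨
  count (λ _ → true) (vectors xs (suc l))
    ≡⟨ count-cartesianProduct _ (λ _ → true) (λ _ → true) (λ _ _ → refl) xs (vectors xs l) ⟩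
  count (λ _ → true) xs * count (λ _ → true) (vectors xs l)
    ≡⟨ cong₂ _*_ (count-true xs) (trans (count-true (vectors xs l)) (length-vectors xs l)) ⟩
  length xs * length xs ^ l ∎
  where open ≡-Reasoning

isLast : ∀ {n} → Fin (suc n) → Bool
isLast {zero}  zero    = true
isLast {suc n} zero    = false
isLast {suc n} (suc x) = isLast x

isLast⇒≡fromℕ : ∀ {n} (x : Fin (suc n)) → isLast x ≡ true → x ≡ fromℕ n
isLast⇒≡fromℕ {zero}  zero    _    = refl
isLast⇒≡fromℕ {suc n} (suc x) last = cong suc (isLast⇒≡fromℕ x last)

count-not-isLast : ∀ n → count (not ∘ isLast) (allFin (suc n)) ≡ n
count-not-isLast zero    = refl
count-not-isLast (suc n) = cong suc (begin
  count (not ∘ isLast) (tabulate {n = suc n} suc)  ≡⟨ cong (count (not ∘ isLast)) (map-tabulate {n = suc n} id suc) ⟨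
  count (not ∘ isLast) (map suc (allFin (suc n)))  ≡⟨ count-map (not ∘ isLast) suc (allFin (suc n)) ⟩
  count (not ∘ isLast) (allFin (suc n))            ≡⟨ count-not-isLast n ⟩
  n                                                ∎)
  where open ≡-Reasoning

count-not-∧-isLast : ∀ n b → count (λ x → not (b ∧ isLast x)) (allFin (suc n)) ≡ (if b then n else suc n)
count-not-∧-isLast n true  = count-not-isLast n
count-not-∧-isLast n false = trans (count-true (allFin (suc n))) (length-tabulate id)

avoidsLast : ∀ {n l} → (ℕ → Bool) → Vec (Fin (suc n)) l → Bool
avoidsLast D []      = true
avoidsLast D (x ∷ u) = not (D 0 ∧ isLast x) ∧ avoidsLast (D ∘ ℕ.suc) u

avoidsLast≡false : ∀ {n l} D (u : Vec (Fin (suc n)) l) → avoidsLast D u ≡ false →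
  ∃[ i ] (D (toℕ i) ≡ true × isLast (lookup u i) ≡ true)
avoidsLast≡false D (x ∷ u) e with D 0 ∧ isLast x in hit
... | true  = zero , ∧-conicalˡ _ _ hit , ∧-conicalʳ _ _ hit
... | false with i , Di , last ← avoidsLast≡false (D ∘ ℕ.suc) u e = suc i , Di , last

count-avoidsLast : ∀ n l D → count (avoidsLast D) (vectors (allFin (suc n)) l) * suc n ^ countBelow D l
                             ≡ n ^ countBelow D l * suc n ^ l
count-avoidsLast n zero    D = refl
count-avoidsLast n (suc l) D = begin
  count (avoidsLast D) (vectors (allFin (suc n)) (suc l)) * suc n ^ (bit (D 0) + c)
    ≡⟨ cong (_* suc n ^ (bit (D 0) + c))
            (count-cartesianProduct (avoidsLast D) (λ x → not (D 0 ∧ isLast x)) (avoidsLast (D ∘ ℕ.suc))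
                                    (λ _ _ → refl) (allFin (suc n)) (vectors (allFin (suc n)) l)) ⟩
  count (λ x → not (D 0 ∧ isLast x)) (allFin (suc n)) * C * suc n ^ (bit (D 0) + c)
    ≡⟨ cong (λ k → k * C * suc n ^ (bit (D 0) + c)) (count-not-∧-isLast n (D 0)) ⟩
  (if D 0 then n else suc n) * C * suc n ^ (bit (D 0) + c)
    ≡⟨ step (D 0) ⟩
  n ^ (bit (D 0) + c) * suc n ^ suc l ∎
  where
  open ≡-Reasoning
  C = count (avoidsLast (D ∘ ℕ.suc)) (vectors (allFin (suc n)) l)
  c = countBelow (D ∘ ℕ.suc) l
  ih : C * suc n ^ c ≡ n ^ c * suc n ^ l
  ih = count-avoidsLast n l (D ∘ ℕ.suc)
  step : ∀ b → (if b then n else suc n) * C * suc n ^ (bit b + c) ≡ n ^ (bit b + c) * suc n ^ suc l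
  step true  = begin
    n * C * (suc n * suc n ^ c)       ≡⟨ regroup n C (suc n) (suc n ^ c) ⟩
    n * suc n * (C * suc n ^ c)       ≡⟨ cong (n * suc n *_) ih ⟩
    n * suc n * (n ^ c * suc n ^ l)   ≡⟨ regroup n (suc n) (n ^ c) (suc n ^ l) ⟩
    n * n ^ c * (suc n * suc n ^ l)   ∎
    where
    regroup : ∀ x y z w → x * y * (z * w) ≡ x * z * (y * w)
    regroup = solve-∀
  step false = begin
    suc n * C * suc n ^ c             ≡⟨ *-assoc (suc n) C _ ⟩
    suc n * (C * suc n ^ c)           ≡⟨ cong (suc n *_) ih ⟩
    suc n * (n ^ c * suc n ^ l)       ≡⟨ x*[y*z]≡y*[x*z] (suc n) (n ^ c) _ ⟩
    n ^ c * (suc n * suc n ^ l)       ∎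
    where
    x*[y*z]≡y*[x*z] : ∀ x y z → x * (y * z) ≡ y * (x * z)
    x*[y*z]≡y*[x*z] = solve-∀

ratio-mono : ∀ x n {m c} → m ≤ c → x * n ^ m ≤ suc n ^ m → x * n ^ c ≤ suc n ^ c
ratio-mono x n {m} {c} m≤c ratio = begin
  x * n ^ c                    ≡⟨ cong (x *_) (^-split n) ⟩
  x * (n ^ m * n ^ e)          ≡⟨ *-assoc x _ _ ⟨
  x * n ^ m * n ^ e            ≤⟨ *-mono-≤ ratio (^-monoˡ-≤ e (n≤1+n n)) ⟩
  suc n ^ m * suc n ^ e        ≡⟨ ^-split (suc n) ⟨
  suc n ^ c                    ∎
  where
  open ≤-Reasoning
  e = c ∸ m
  ^-split : ∀ y → y ^ c ≡ y ^ m * y ^ e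
  ^-split y = trans (cong (y ^_) (sym (m+[n∸m]≡n m≤c))) (^-distribˡ-+-* y m e)

count-avoidsLast-≤ : ∀ x n {m d} D → m ≤ countBelow D d → x * n ^ m ≤ suc n ^ m →
  x * count (avoidsLast D) (vectors (allFin (suc n)) d) ≤ suc n ^ d
count-avoidsLast-≤ x n {m} {d} D m≤c ratio = *-cancelʳ-≤ _ _ (suc n ^ c) {{m^n≢0 (suc n) c}} (begin
  x * C * suc n ^ c             ≡⟨ *-assoc x C _ ⟩
  x * (C * suc n ^ c)           ≡⟨ cong (x *_) (count-avoidsLast n d D) ⟩
  x * (n ^ c * suc n ^ d)       ≡⟨ *-assoc x _ _ ⟨
  x * n ^ c * suc n ^ d         ≤⟨ *-monoˡ-≤ (suc n ^ d) (ratio-mono x n m≤c ratio) ⟩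
  suc n ^ c * suc n ^ d         ≡⟨ *-comm (suc n ^ c) _ ⟩
  suc n ^ d * suc n ^ c         ∎)
  where
  open ≤-Reasoning
  C = count (avoidsLast D) (vectors (allFin (suc n)) d)
  c = countBelow D d

-- Letters are punched in around the hole, which at a coordinate of type b is k − 1 (b = true)
-- or k (b = false), where k = n + 2; so the last symbol of Fin (suc n) becomes k exactly on
-- the coordinates of type true.
hole : ∀ {n} → Bool → Fin (suc (suc n))
hole {n} true  = inject₁ (fromℕ n)
hole {n} false = fromℕ (suc n)

toℕ-hole : ∀ n b → toℕ (hole {n} b) ≡ (if b then n else suc n)
toℕ-hole n true  = trans (toℕ-inject₁ (fromℕ n)) (toℕ-fromℕ n)
toℕ-hole n false = toℕ-fromℕ (suc n)

encode : ∀ {n l} → (ℕ → Bool) → Vec (Fin (suc n)) l → Vec (Fin (suc (suc n))) l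
encode c []      = []
encode c (x ∷ u) = punchIn (hole (c 0)) x ∷ encode (c ∘ ℕ.suc) u

lookup-encode : ∀ {n l} c (u : Vec (Fin (suc n)) l) i → lookup (encode c u) i ≡ punchIn (hole (c (toℕ i))) (lookup u i)
lookup-encode c (x ∷ u) zero    = refl
lookup-encode c (x ∷ u) (suc i) = lookup-encode (c ∘ ℕ.suc) u i

encode-injective : ∀ {n l} c {u v : Vec (Fin (suc n)) l} → encode c u ≡ encode c v → u ≡ v
encode-injective c {[]}    {[]}    _ = refl
encode-injective c {x ∷ u} {y ∷ v} e with ∷-injective e
... | x≡y , u≡v = cong₂ _∷_ (punchIn-injective (hole (c 0)) x y x≡y) (encode-injective (c ∘ ℕ.suc) u≡v)

letter-encode-≢ : ∀ {n l} c (u : Vec (Fin (suc n)) l) i → letter (encode c u) i ≢ suc (toℕ (hole (c (toℕ i))))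
letter-encode-≢ c u i e = punchInᵢ≢i (hole (c (toℕ i))) (lookup u i)
  (toℕ-injective (suc-injective (trans (cong (ℕ.suc ∘ toℕ) (sym (lookup-encode c u i))) e)))

punchIn-fromℕ : ∀ n → punchIn (inject₁ (fromℕ n)) (fromℕ n) ≡ fromℕ (suc n)
punchIn-fromℕ zero    = refl
punchIn-fromℕ (suc n) = cong suc (punchIn-fromℕ n)

letter-< : ∀ {k d} (w : Word k d) i → letter w i ≢ k → letter w i < k
letter-< w i ≢k = ≤∧≢⇒< (toℕ<n (lookup w i)) ≢k

separator : ℕ → ℕ → ℕ → ℕ → Bool
separator R n j i = walsh R (suc n) i ∧ not (walsh R (suc j) i)

separator-dense : ∀ r {d q n j} → q * 2 ^ (2 + r) ≤ d → suc n < 2 ^ (2 + r) → j < n →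
  q * 2 ^ r ≤ countBelow (separator (2 + r) n j) d
separator-dense r {d} {q} qP≤d 1+n<P j<n =
  walsh-difference-≥ r d q z<s z<s (λ e → <⇒≢ j<n (sym (suc-injective e))) 1+n<P (<-trans (s<s j<n) 1+n<P) qP≤d

separatesAll : ∀ {n d} → ℕ → Vec (Fin (suc n)) d → Bool
separatesAll {n} R u = all (λ j → not (avoidsLast (separator R n j) u)) (upTo n)

walshLanguage : ℕ → (d k : ℕ) → Language k d
walshLanguage R d (suc (suc n)) = record
  { words  = map (encode (walsh R (suc n))) (filterᵇ (separatesAll R) (vectors (allFin (suc n)) d))
  ; unique = Unique.map⁺ (encode-injective (walsh R (suc n)))
               (Unique.filter⁺ (T? ∘ separatesAll R) (vectors-unique (Unique.allFin⁺ (suc n)) d))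
  }
walshLanguage R d _ = record { words = [] ; unique = [] }

∈-walshLanguage : ∀ {R d n w} → w ∈L walshLanguage R d (2 + n) →
  ∃[ u ] (w ≡ encode (walsh R (suc n)) u × T (separatesAll R u))
∈-walshLanguage {R} {d} {n} w∈L with u , u∈ , refl ← ∈-map⁻ (encode (walsh R (suc n))) w∈L =
  u , refl , proj₂ (∈-filter⁻ (T? ∘ separatesAll R) {xs = vectors (allFin (suc n)) d} u∈)

walshLanguage-misses : ∀ R d n i → Misses (walshLanguage R d (2 + n)) (suc (if walsh R (suc n) (toℕ i) then n else suc n)) i
walshLanguage-misses R d n i w w∈L with u , refl , _ ← ∈-walshLanguage {R} {d} {n} w∈L =
  subst (λ h → letter w i ≢ suc h) (toℕ-hole n (walsh R (suc n) (toℕ i))) (letter-encode-≢ (walsh R (suc n)) u i)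

walshLanguage-gapped : ∀ R d n → Gapped (walshLanguage R d (2 + n))
walshLanguage-gapped R d n i with walsh R (suc n) (toℕ i) | walshLanguage-misses R d n i
... | true  | misses = inj₁ misses
... | false | misses = inj₂ misses

separatesAll⇒avoidsLast≡false : ∀ {R n n' d} (u : Vec (Fin (suc n')) d) → n < n' → T (separatesAll R u) →
  avoidsLast (separator R n' n) u ≡ false
separatesAll⇒avoidsLast≡false {R} {n} {n'} u n<n' sep =
  Equivalence.to T-not-≡ (All.lookup (all⁺ (λ j → not (avoidsLast (separator R n' j) u)) (upTo n') sep) (∈-upTo⁺ n<n'))

walshLanguage-separated : ∀ R d {n n'} → n < n' → Separated (walshLanguage R d (2 + n)) (walshLanguage R d (2 + n'))
walshLanguage-separated R d {n} {n'} n<n' w w' w∈L w'∈L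
  with u' , refl , sep ← ∈-walshLanguage {R} {d} {n'} w'∈L
  with i , hit , last ← avoidsLast≡false (separator R n' n) u' (separatesAll⇒avoidsLast≡false {R} u' n<n' sep)
  = i , letter-< w i letter≢k , letter≡
  where
  type-n′ : walsh R (suc n') (toℕ i) ≡ true
  type-n′ = ∧-conicalˡ (walsh R (suc n') (toℕ i)) _ hit
  type-n : walsh R (suc n) (toℕ i) ≡ false
  type-n = trans (sym (not-involutive _)) (cong not (∧-conicalʳ (walsh R (suc n') (toℕ i)) _ hit))
  letter≢k : letter w i ≢ suc (suc n)
  letter≢k = subst (λ b → letter w i ≢ suc (if b then n else suc n)) type-n (walshLanguage-misses R d n i w w∈L)
  letter≡ : letter (encode (walsh R (suc n')) u') i ≡ suc (suc n')
  letter≡ = begin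
    suc (toℕ (lookup (encode (walsh R (suc n')) u') i))
      ≡⟨ cong (ℕ.suc ∘ toℕ) (lookup-encode (walsh R (suc n')) u' i) ⟩
    suc (toℕ (punchIn (hole (walsh R (suc n') (toℕ i))) (lookup u' i)))
      ≡⟨ cong₂ (λ b x → suc (toℕ (punchIn (hole {n'} b) x))) type-n′ (isLast⇒≡fromℕ (lookup u' i) last) ⟩
    suc (toℕ (punchIn (inject₁ (fromℕ n')) (fromℕ n')))
      ≡⟨ cong (ℕ.suc ∘ toℕ) (punchIn-fromℕ n') ⟩
    suc (toℕ (fromℕ (suc n')))
      ≡⟨ cong suc (toℕ-fromℕ (suc n')) ⟩
    suc (suc n') ∎
    where open ≡-Reasoning

-- Union bound: each of the n separators is avoided by at most (n+1)^d / (11 n) words.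
walshLanguage-size : ∀ R d n m → (∀ j → j < n → m ≤ countBelow (separator R n j) d) → 11 * n * n ^ m ≤ suc n ^ m →
  10 * suc n ^ d ≤ 11 * ∣ walshLanguage R d (2 + n) ∣L
walshLanguage-size R d n m dense ratio = subst (λ g → 10 * N ≤ 11 * g) (sym size≡G) (+-cancelʳ-≤ N (10 * N) (11 * G) (begin
  10 * N + N          ≡⟨ +-comm (10 * N) N ⟩
  11 * N              ≤⟨ *-monoʳ-≤ 11 (subst (_≤ G + B) length-vs (count-all-not bad (upTo n) vs)) ⟩
  11 * (G + B)        ≡⟨ *-distribˡ-+ 11 G B ⟩
  11 * G + 11 * B     ≤⟨ +-monoʳ-≤ (11 * G) (sum-upTo-≤ 11 N n (λ j → count (bad j) vs) bad≤) ⟩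
  11 * G + N          ∎))
  where
  open ≤-Reasoning
  N = suc n ^ d
  vs = vectors (allFin (suc n)) d
  bad = λ j → avoidsLast (separator R n j)
  B = sum (map (λ j → count (bad j) vs) (upTo n))
  G = count (separatesAll R) vs
  size≡G : ∣ walshLanguage R d (2 + n) ∣L ≡ G
  size≡G = trans (length-map (encode (walsh R (suc n))) (filterᵇ (separatesAll R) vs)) (length-filterᵇ (separatesAll R) vs)
  length-vs : length vs ≡ N
  length-vs = trans (length-vectors (allFin (suc n)) d) (cong (_^ d) (length-tabulate id))
  bad≤ : ∀ j → j < n → 11 * n * count (bad j) vs ≤ N
  bad≤ j j<n = count-avoidsLast-≤ (11 * n) n {d = d} (separator R n j) (dense j j<n) ratio

-- Choice of the block length

power-of-two-between : ∀ x → 1 ≤ x → ∃[ R ] (x ≤ 2 ^ R × 2 ^ R ≤ 2 * x)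
power-of-two-between (suc zero)    _ = 0 , ≤-refl , s≤s z≤n
power-of-two-between (suc (suc x)) _ with power-of-two-between (suc x) (s≤s z≤n)
... | R , x<2^R , 2^R≤2x with suc (suc x) ≤? 2 ^ R
...   | yes fits = R , fits , ≤-trans 2^R≤2x (*-monoʳ-≤ 2 (n≤1+n (suc x)))
...   | no ¬fits = suc R , (begin
          2 + x          ≤⟨ +-monoʳ-≤ 2 (m≤n*m x 2) ⟩
          2 + 2 * x      ≡⟨ *-suc 2 x ⟨
          2 * suc x      ≡⟨ cong (2 *_) 2^R≡1+x ⟨
          2 * 2 ^ R      ∎) , *-monoʳ-≤ 2 (≤-trans (≤-reflexive 2^R≡1+x) (n≤1+n (suc x)))
  where
  open ≤-Reasoning
  2^R≡1+x : 2 ^ R ≡ suc x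
  2^R≡1+x = ≤-antisym (≤-pred (≰⇒> ¬fits)) x<2^R

-- With at least 8 complete blocks, the incomplete one is at most an eighth of the complete ones.
8*d≤9*[d/P]*P : ∀ d P .{{_ : NonZero P}} → 8 * P ≤ d → 8 * d ≤ 9 * (d / P * P)
8*d≤9*[d/P]*P d P 8P≤d = begin
  8 * d                 ≤⟨ *-monoʳ-≤ 8 (<⇒≤ d<P+qP) ⟩
  8 * (P + q * P)       ≡⟨ *-distribˡ-+ 8 P (q * P) ⟩
  8 * P + 8 * (q * P)   ≤⟨ +-monoˡ-≤ (8 * (q * P)) (*-monoˡ-≤ P 8≤q) ⟩
  q * P + 8 * (q * P)   ≡⟨⟩
  9 * (q * P)           ∎
  where
  open ≤-Reasoning
  q = d / P
  d<P+qP : d < P + q * P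
  d<P+qP = begin-strict
    d               ≡⟨ m≡m%n+[m/n]*n d P ⟩
    d % P + q * P   <⟨ +-monoˡ-< (q * P) (m%n<n d P) ⟩
    P + q * P       ∎
  8≤q : 8 ≤ q
  8≤q with 8 ≤? q
  ... | yes 8≤q = 8≤q
  ... | no  q<8 = contradiction d<P+qP (≤⇒≯ (begin
    P + q * P         ≤⟨ +-monoʳ-≤ P (*-monoˡ-≤ P (≤-pred (≰⇒> q<8))) ⟩
    8 * P             ≤⟨ 8P≤d ⟩
    d                 ∎))

-- P = 2^(2+r) ≥ S + 4 is at most 2(S + 4) ≤ d/8, so at least 8 blocks of length P fit in d.
block-decomposition : ∀ {d S} → 16 * S + 64 ≤ d →
  ∃[ r ] ∃[ q ] (S < 2 ^ (2 + r) × q * 2 ^ (2 + r) ≤ d × 2 * d ≤ 9 * (q * 2 ^ r))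
block-decomposition {d} {S} 16S+64≤d with power-of-two-between (4 + S) (s≤s z≤n)
... | zero        , s≤s ()          , _
... | suc zero    , s≤s (s≤s ())    , _
... | suc (suc r) , 4+S≤P , P≤2[4+S] =
  r , d / P , ≤-trans (m≤n+m (suc S) 3) 4+S≤P , m/n*n≤m d P , *-cancelˡ-≤ 4 (begin
    4 * (2 * d)               ≡⟨ *-assoc 4 2 d ⟨
    8 * d                     ≤⟨ 8*d≤9*[d/P]*P d P 8P≤d ⟩
    9 * (d / P * P)           ≡⟨ regroup (d / P) (2 ^ r) ⟩
    4 * (9 * (d / P * 2 ^ r)) ∎)
  where
  open ≤-Reasoning
  P = 2 ^ (2 + r)
  instance
    P≢0 : NonZero P
    P≢0 = m^n≢0 2 (2 + r)
  8P≤d : 8 * P ≤ d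
  8P≤d = begin
    8 * P             ≤⟨ *-monoʳ-≤ 8 P≤2[4+S] ⟩
    8 * (2 * (4 + S)) ≡⟨ expand S ⟩
    16 * S + 64       ≤⟨ 16S+64≤d ⟩
    d                 ∎
    where
    expand : ∀ S → 8 * (2 * (4 + S)) ≡ 16 * S + 64
    expand = solve-∀
  regroup : ∀ q x → 9 * (q * (2 * (2 * x))) ≡ 4 * (9 * (q * x))
  regroup = solve-∀

lemma5 : ∃[ d₀ ] ∀ (d : ℕ) → d₀ ≤ d → ∀ (S : ℕ) → IsCeilS d S →
    Σ ((k : ℕ) → Language k d) λ L →
      (∀ k → 2 ≤ k → k ≤ S → Gapped (L k) × 10 * (k ∸ 1) ^ d ≤ 11 * ∣ L k ∣L)
      × (∀ k k' → 2 ≤ k → k < k' → k' ≤ S → Separated (L k) (L k'))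
lemma5 = 2 ^ 15 , λ d 2^15≤d S (_ , e^2d≰d^[9[S∸1]]) →
  let d-large = 16S+64≤d {d} {S} 2^15≤d e^2d≰d^[9[S∸1]]
      r , q , S<P , qP≤d , 2d≤9m = block-decomposition d-large
      R = 2 + r
      large : ∀ n → 2 + n ≤ S → 10 * suc n ^ d ≤ 11 * ∣ walshLanguage R d (2 + n) ∣L
      large n k≤S = walshLanguage-size R d n (q * 2 ^ r)
                      (λ j j<n → separator-dense r {q = q} qP≤d (≤-trans k≤S (<⇒≤ S<P)) j<n)
                      (ratio-from-ceiling {d} {S} {n} {q * 2 ^ r} e^2d≰d^[9[S∸1]] d-large 2d≤9m k≤S)
  in walshLanguage R d
   , (λ { (suc (suc n)) _ k≤S → walshLanguage-gapped R d n , large n k≤S ; (suc zero) (s≤s ()) _ })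
   , (λ { (suc (suc n)) (suc (suc n')) _ (s≤s (s≤s n<n')) _ → walshLanguage-separated R d n<n'
        ; (suc zero) _ (s≤s ()) _ _ ; (suc (suc n)) (suc zero) _ (s≤s ()) _ })
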